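{- Let $n\ge 1$ and let $\mathcal A,\mathcal B\subset 2^{[n]}$ be cross-IU families with $|\mathcal A|\ge|\mathcal B|$. Then $|\mathcal A|+3|\mathcal B|\le 2^n$.
   Context: Families $\mathcal A,\mathcal B\subset 2^{[n]}$ are cross-IU if for all $A\in\mathcal A$ and $B\in\mathcal B$ we have both $A\cap B\ne\emptyset$ and $A\cup B\ne[n]$. -}

module Defs where

open import Data.Bool using (Bool; true; false; T)
open import Data.Nat using (ℕ; zero; suc)
open import Data.List using (List; []; _∷_; map; _++_; length; filter)
open import Data.Vec using (_∷_; [])
open import Data.Fin.Subset using (Subset; _∩_; _∪_; ⊤; Nonempty; inside; outside)
open import Relation.Binary.PropositionalEquality using (_≡_)
open import Relation.Nullary using (¬_)
open import Data.Bool.Properties using (T?)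

Family : ℕ → Set
Family n = Subset n → Bool

allSubsets : (n : ℕ) → List (Subset n)
allSubsets zero = [] ∷ []
allSubsets (suc n) = map (outside ∷_) (allSubsets n) ++ map (inside ∷_) (allSubsets n)

card : {n : ℕ} → Family n → ℕ
card {n} F = length (filter (λ S → T? (F S)) (allSubsets n))

CrossIU : {n : ℕ} → Family n → Family n → Set
CrossIU {n} 𝓐 𝓑 = (A B : Subset n) → T (𝓐 A) → T (𝓑 B) →
  Nonempty (A ∩ B) × ¬ (A ∪ B ≡ ⊤)
  where open import Data.Product using (_×_)

-- Let 𝓓 be the family of sets disjoint from some member of 𝓑 (a down-set) and 𝓤 the family
-- of sets whose union with some member of 𝓑 is [n] (an up-set). Cross-IU says exactly that 𝓐
-- avoids 𝓓 ∪ 𝓤, while the complement of every member of 𝓑 lies in 𝓓 ∩ 𝓤. Writing N = 2^n, this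
-- gives |𝓐| + |𝓓| + |𝓤| ≤ N + |𝓓 ∩ 𝓤| and |𝓑| ≤ |𝓓 ∩ 𝓤|, and the Harris–Kleitman inequality
-- N |𝓓 ∩ 𝓤| ≤ |𝓓| |𝓤| controls the overlap. If |𝓓| + |𝓤| ≤ N, AM–GM turns this into
-- N (|𝓐| + 3|𝓑|) ≤ N²; otherwise N |𝓐| ≤ (N − |𝓓|)(N − |𝓤|) ≤ N²/4 and |𝓐| + 3|𝓑| ≤ 4|𝓐|.

module Submission where

open import Algebra.Properties.CommutativeSemigroup using (interchange; x∙yz≈y∙xz)
open import Data.Bool using (Bool; true; false; T; not; _∧_; _∨_)
open import Data.Bool.Properties using (T?)
import Data.Bool.Properties as Bool
open import Data.Empty using (⊥-elim)
open import Data.Fin.Subset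
  using (Subset; _∈_; _⊆_; _∩_; _∪_; ∁; ⊤; inside; outside)
open import Data.Fin.Subset.Properties
  using (s⊆s; out⊆; ⊆-refl; ⊆-antisym; ⊆⊤; ∉⊥; x∈p∪q⁺; x∈p∪q⁻; x∈p∩q⁺; x∈p∩q⁻;
         ∩-inverseʳ; ∪-inverseʳ; nonempty?; anySubset?)
open import Data.List using (List; []; _∷_; map; filter; length; _++_)
open import Data.List.Properties using (length-map; length-++; filter-++)
open import Data.Nat using (ℕ; zero; suc; z≤n; _≤_; _+_; _*_; _^_; NonZero)
open import Data.Nat.Properties
open import Data.Nat.Tactic.RingSolver using (solve-∀)
open import Data.Product using (_,_; proj₁; proj₂)
import Data.Product as Product
open import Data.Sum using ([_,_]′)
import Data.Sum as Sum
open import Data.Vec using (_∷_; [])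
open import Data.Vec.Properties using (≡-dec)
open import Function using (_∘_)
open import Function.Bundles using (Equivalence)
open import Relation.Binary.PropositionalEquality
open import Relation.Nullary using (¬_; ¬?; does)
open import Relation.Nullary.Decidable using (⌊_⌋; _×-dec_; toWitness; fromWitness)
open import Relation.Unary using (Decidable)

open import Defs

private variable
  n : ℕ

chebyshev : ∀ {d₀ d₁ u₀ u₁} → d₁ ≤ d₀ → u₀ ≤ u₁ →
  2 * (d₀ * u₀ + d₁ * u₁) ≤ (d₀ + d₁) * (u₀ + u₁)
chebyshev {d₀} {d₁} {u₀} {u₁} d₁≤d₀ u₀≤u₁
  with x , refl ← m≤n⇒∃[o]m+o≡n d₁≤d₀ | y , refl ← m≤n⇒∃[o]m+o≡n u₀≤u₁ =
  ≤-trans (m≤m+n _ (x * y)) (≤-reflexive (expand d₁ x u₀ y))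
  where
  expand : ∀ d x u y →
    2 * ((d + x) * u + d * (u + y)) + x * y ≡ ((d + x) + d) * (u + (u + y))
  expand = solve-∀

4mn≤[m+n]² : ∀ m n → 4 * (m * n) ≤ (m + n) * (m + n)
4mn≤[m+n]² m n = [ ordered , swapped ]′ (≤-total m n)
  where
  ordered : ∀ {m n} → m ≤ n → 4 * (m * n) ≤ (m + n) * (m + n)
  ordered {m} m≤n with k , refl ← m≤n⇒∃[o]m+o≡n m≤n =
    ≤-trans (m≤m+n _ (k * k)) (≤-reflexive (expand m k))
    where
    expand : ∀ m k → 4 * (m * (m + k)) + k * k ≡ (m + (m + k)) * (m + (m + k))
    expand = solve-∀
  swapped : n ≤ m → 4 * (m * n) ≤ (m + n) * (m + n)
  swapped n≤m = subst₂ _≤_ (cong (4 *_) (*-comm n m)) (cong (λ s → s * s) (+-comm n m)) (ordered n≤m)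

bound-if-d+u≤N : ∀ {N a c d u} → d + u ≤ N →
  N * a + N * (d + u) ≤ N * N + d * u → N * c ≤ d * u → N * (a + 3 * c) ≤ N * N
bound-if-d+u≤N {N} {a} {c} {d} {u} d+u≤N key Nc≤du = +-cancelʳ-≤ (N * (d + u)) _ _ (begin
  N * (a + 3 * c) + N * (d + u)       ≡⟨ regroup N a c (N * (d + u)) ⟩
  (N * a + N * (d + u)) + 3 * (N * c) ≤⟨ +-mono-≤ key (*-monoʳ-≤ 3 Nc≤du) ⟩
  (N * N + d * u) + 3 * (d * u)       ≡⟨ +-assoc (N * N) (d * u) _ ⟩
  N * N + 4 * (d * u)                 ≤⟨ +-monoʳ-≤ (N * N) (4mn≤[m+n]² d u) ⟩
  N * N + (d + u) * (d + u)           ≤⟨ +-monoʳ-≤ (N * N) (*-monoˡ-≤ (d + u) d+u≤N) ⟩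
  N * N + N * (d + u)                 ∎)
  where
  open ≤-Reasoning
  regroup : ∀ N a c X → N * (a + 3 * c) + X ≡ (N * a + X) + 3 * (N * c)
  regroup = solve-∀

bound-if-N≤d+u : ∀ {N a c d u} → N ≤ d + u → d ≤ N → u ≤ N →
  N * a + N * (d + u) ≤ N * N + d * u → c ≤ a → N * (a + 3 * c) ≤ N * N
bound-if-N≤d+u {N} {a} {c} {d} {u} N≤d+u d≤N u≤N key c≤a
  with p , d+p≡N ← m≤n⇒∃[o]m+o≡n d≤N | q , u+q≡N ← m≤n⇒∃[o]m+o≡n u≤N = begin
  N * (a + 3 * c)   ≤⟨ *-monoʳ-≤ N (+-monoʳ-≤ a (*-monoʳ-≤ 3 c≤a)) ⟩
  N * (4 * a)       ≡⟨ x∙yz≈y∙xz *-commutativeSemigroup N 4 a ⟩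
  4 * (N * a)       ≤⟨ *-monoʳ-≤ 4 Na≤pq ⟩
  4 * (p * q)       ≤⟨ 4mn≤[m+n]² p q ⟩
  (p + q) * (p + q) ≤⟨ *-mono-≤ p+q≤N p+q≤N ⟩
  N * N             ∎
  where
  open ≤-Reasoning
  complement-identity : N * N + d * u ≡ p * q + N * (d + u)
  complement-identity = begin-equality
    N * N + d * u
      ≡⟨ cong₂ (λ x y → x * y + d * u) (sym d+p≡N) (sym u+q≡N) ⟩
    (d + p) * (u + q) + d * u
      ≡⟨ expand d p u q ⟩
    p * q + ((u + q) * d + (d + p) * u)
      ≡⟨ cong₂ (λ x y → p * q + (x * d + y * u)) u+q≡N d+p≡N ⟩
    p * q + (N * d + N * u)
      ≡⟨ cong (p * q +_) (sym (*-distribˡ-+ N d u)) ⟩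
    p * q + N * (d + u) ∎
    where
    expand : ∀ d p u q → (d + p) * (u + q) + d * u ≡ p * q + ((u + q) * d + (d + p) * u)
    expand = solve-∀
  Na≤pq : N * a ≤ p * q
  Na≤pq = +-cancelʳ-≤ (N * (d + u)) _ _ (≤-trans key (≤-reflexive complement-identity))
  p+q≤N : p + q ≤ N
  p+q≤N = +-cancelʳ-≤ N _ _ (begin
    (p + q) + N       ≤⟨ +-monoʳ-≤ (p + q) N≤d+u ⟩
    (p + q) + (d + u) ≡⟨ shuffle p q d u ⟩
    (d + p) + (u + q) ≡⟨ cong₂ _+_ d+p≡N u+q≡N ⟩
    N + N             ∎)
    where
    shuffle : ∀ p q d u → (p + q) + (d + u) ≡ (d + p) + (u + q)
    shuffle = solve-∀

a+3c≤N : ∀ N .{{_ : NonZero N}} {a c d u i} →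
  a + (d + u) ≤ N + i → c ≤ i → N * i ≤ d * u → c ≤ a → d ≤ N → u ≤ N → a + 3 * c ≤ N
a+3c≤N N {a} {c} {d} {u} {i} a+d+u≤N+i c≤i Ni≤du c≤a d≤N u≤N = *-cancelˡ-≤ N
  ([ (λ d+u≤N → bound-if-d+u≤N {d = d} {u} d+u≤N key Nc≤du)
   , (λ N≤d+u → bound-if-N≤d+u N≤d+u d≤N u≤N key c≤a)
   ]′ (≤-total (d + u) N))
  where
  open ≤-Reasoning
  key : N * a + N * (d + u) ≤ N * N + d * u
  key = begin
    N * a + N * (d + u) ≡⟨ sym (*-distribˡ-+ N a (d + u)) ⟩
    N * (a + (d + u))   ≤⟨ *-monoʳ-≤ N a+d+u≤N+i ⟩
    N * (N + i)         ≡⟨ *-distribˡ-+ N N i ⟩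
    N * N + N * i       ≤⟨ +-monoʳ-≤ (N * N) Ni≤du ⟩
    N * N + d * u       ∎
  Nc≤du : N * c ≤ d * u
  Nc≤du = ≤-trans (*-monoʳ-≤ N c≤i) Ni≤du

∩-monoˡ-⊆ : {p q r : Subset n} → p ⊆ q → p ∩ r ⊆ q ∩ r
∩-monoˡ-⊆ {p = p} {r = r} p⊆q = x∈p∩q⁺ ∘ Product.map₁ p⊆q ∘ x∈p∩q⁻ p r

∪-monoˡ-⊆ : {p q r : Subset n} → p ⊆ q → p ∪ r ⊆ q ∪ r
∪-monoˡ-⊆ {p = p} {r = r} p⊆q = x∈p∪q⁺ ∘ Sum.map₁ p⊆q ∘ x∈p∪q⁻ p r

infixr 7 _∧ᶠ_
infixr 6 _∨ᶠ_
infix 4 _⊆ᶠ_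

_∧ᶠ_ _∨ᶠ_ : Family n → Family n → Family n
(F ∧ᶠ G) S = F S ∧ G S
(F ∨ᶠ G) S = F S ∨ G S

notᶠ : Family n → Family n
notᶠ F S = not (F S)

_⊆ᶠ_ : Family n → Family n → Set
F ⊆ᶠ G = ∀ S → T (F S) → T (G S)

Disjointᶠ : Family n → Family n → Set
Disjointᶠ F G = ∀ S → T (F S) → ¬ T (G S)

slice : Bool → Family (suc n) → Family n
slice x F S = F (x ∷ S)

filter-map : ∀ {A B : Set} {P : B → Set} (P? : Decidable P) (f : A → B) (xs : List A) →
  filter P? (map f xs) ≡ map f (filter (P? ∘ f) xs)
filter-map P? f [] = refl
filter-map P? f (x ∷ xs) with does (P? (f x))
... | true  = cong (f x ∷_) (filter-map P? f xs)
... | false = filter-map P? f xs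

card-slices : (F : Family (suc n)) → card F ≡ card (slice outside F) + card (slice inside F)
card-slices {n} F = begin
  length (filter P? (map (outside ∷_) Ss ++ map (inside ∷_) Ss))
    ≡⟨ cong length (filter-++ P? (map (outside ∷_) Ss) _) ⟩
  length (filter P? (map (outside ∷_) Ss) ++ filter P? (map (inside ∷_) Ss))
    ≡⟨ length-++ (filter P? (map (outside ∷_) Ss)) ⟩
  length (filter P? (map (outside ∷_) Ss)) + length (filter P? (map (inside ∷_) Ss))
    ≡⟨ cong₂ _+_ (length-filter-map outside) (length-filter-map inside) ⟩
  card (slice outside F) + card (slice inside F) ∎
  where
  open ≡-Reasoning
  Ss = allSubsets n
  P? = λ S → T? (F S)
  length-filter-map : ∀ x → length (filter P? (map (x ∷_) Ss)) ≡ card (slice x F)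
  length-filter-map x = trans (cong length (filter-map P? (x ∷_) Ss))
                              (length-map (x ∷_) (filter (P? ∘ (x ∷_)) Ss))

card-+-card-notᶠ : (F : Family n) → card F + card (notᶠ F) ≡ 2 ^ n
card-+-card-notᶠ {zero} F with F []
... | true  = refl
... | false = refl
card-+-card-notᶠ {suc n} F = begin
  card F + card (notᶠ F)
    ≡⟨ cong₂ _+_ (card-slices F) (card-slices (notᶠ F)) ⟩
  (card F₀ + card F₁) + (card (notᶠ F₀) + card (notᶠ F₁))
    ≡⟨ interchange +-commutativeSemigroup (card F₀) (card F₁) _ _ ⟩
  (card F₀ + card (notᶠ F₀)) + (card F₁ + card (notᶠ F₁))
    ≡⟨ cong₂ _+_ (card-+-card-notᶠ F₀) (card-+-card-notᶠ F₁) ⟩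
  2 ^ n + 2 ^ n
    ≡⟨ cong (2 ^ n +_) (sym (+-identityʳ (2 ^ n))) ⟩
  2 ^ suc n ∎
  where
  open ≡-Reasoning
  F₀ = slice outside F
  F₁ = slice inside F

card-mono : {F G : Family n} → F ⊆ᶠ G → card F ≤ card G
card-mono {zero} {F} {G} F⊆G with F [] | G [] | F⊆G []
... | true  | true  | _  = ≤-refl
... | true  | false | F⊆G[] = ⊥-elim (F⊆G[] _)
... | false | _     | _  = z≤n
card-mono {suc n} {F} {G} F⊆G rewrite card-slices F | card-slices G =
  +-mono-≤ (card-mono (F⊆G ∘ (outside ∷_))) (card-mono (F⊆G ∘ (inside ∷_)))

card-∨ᶠ-+-card-∧ᶠ : (F G : Family n) → card (F ∨ᶠ G) + card (F ∧ᶠ G) ≡ card F + card G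
card-∨ᶠ-+-card-∧ᶠ {zero} F G with F [] | G []
... | true  | true  = refl
... | true  | false = refl
... | false | true  = refl
... | false | false = refl
card-∨ᶠ-+-card-∧ᶠ {suc n} F G = begin
  card (F ∨ᶠ G) + card (F ∧ᶠ G)
    ≡⟨ cong₂ _+_ (card-slices (F ∨ᶠ G)) (card-slices (F ∧ᶠ G)) ⟩
  (card (F₀ ∨ᶠ G₀) + card (F₁ ∨ᶠ G₁)) + (card (F₀ ∧ᶠ G₀) + card (F₁ ∧ᶠ G₁))
    ≡⟨ interchange +-commutativeSemigroup (card (F₀ ∨ᶠ G₀)) _ _ _ ⟩
  (card (F₀ ∨ᶠ G₀) + card (F₀ ∧ᶠ G₀)) + (card (F₁ ∨ᶠ G₁) + card (F₁ ∧ᶠ G₁))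
    ≡⟨ cong₂ _+_ (card-∨ᶠ-+-card-∧ᶠ F₀ G₀) (card-∨ᶠ-+-card-∧ᶠ F₁ G₁) ⟩
  (card F₀ + card G₀) + (card F₁ + card G₁)
    ≡⟨ interchange +-commutativeSemigroup (card F₀) _ _ _ ⟩
  (card F₀ + card F₁) + (card G₀ + card G₁)
    ≡⟨ sym (cong₂ _+_ (card-slices F) (card-slices G)) ⟩
  card F + card G ∎
  where
  open ≡-Reasoning
  F₀ = slice outside F
  F₁ = slice inside F
  G₀ = slice outside G
  G₁ = slice inside G

card-∘-∁ : (F : Family n) → card (F ∘ ∁) ≡ card F
card-∘-∁ {zero} F with F []
... | true  = refl
... | false = refl
card-∘-∁ {suc n} F = begin
  card (F ∘ ∁)
    ≡⟨ card-slices (F ∘ ∁) ⟩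
  card (slice inside F ∘ ∁) + card (slice outside F ∘ ∁)
    ≡⟨ +-comm (card (slice inside F ∘ ∁)) _ ⟩
  card (slice outside F ∘ ∁) + card (slice inside F ∘ ∁)
    ≡⟨ cong₂ _+_ (card-∘-∁ (slice outside F)) (card-∘-∁ (slice inside F)) ⟩
  card (slice outside F) + card (slice inside F)
    ≡⟨ sym (card-slices F) ⟩
  card F ∎
  where open ≡-Reasoning

card≤2^n : (F : Family n) → card F ≤ 2 ^ n
card≤2^n F = ≤-trans (m≤m+n (card F) (card (notᶠ F))) (≤-reflexive (card-+-card-notᶠ F))

card-+-card≤2^n : {F G : Family n} → Disjointᶠ F G → card F + card G ≤ 2 ^ n
card-+-card≤2^n {n} {F} {G} disjoint = begin
  card F + card G        ≤⟨ +-monoʳ-≤ (card F) (card-mono G⊆notF) ⟩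
  card F + card (notᶠ F) ≡⟨ card-+-card-notᶠ F ⟩
  2 ^ n                  ∎
  where
  open ≤-Reasoning
  G⊆notF : G ⊆ᶠ notᶠ F
  G⊆notF S GS with F S | disjoint S
  ... | true  | FS⇒¬GS = FS⇒¬GS _ GS
  ... | false | _       = _

IsDownSet IsUpSet : Family n → Set
IsDownSet F = ∀ {R S} → R ⊆ S → T (F S) → T (F R)
IsUpSet   F = ∀ {R S} → R ⊆ S → T (F R) → T (F S)

slice-IsDownSet : ∀ {F : Family (suc n)} x → IsDownSet F → IsDownSet (slice x F)
slice-IsDownSet x down R⊆S = down (s⊆s R⊆S)

slice-IsUpSet : ∀ {F : Family (suc n)} x → IsUpSet F → IsUpSet (slice x F)
slice-IsUpSet x up R⊆S = up (s⊆s R⊆S)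

IsDownSet⇒slice-inside⊆slice-outside : {F : Family (suc n)} →
  IsDownSet F → slice inside F ⊆ᶠ slice outside F
IsDownSet⇒slice-inside⊆slice-outside down S = down (out⊆ ⊆-refl)

IsUpSet⇒slice-outside⊆slice-inside : {F : Family (suc n)} →
  IsUpSet F → slice outside F ⊆ᶠ slice inside F
IsUpSet⇒slice-outside⊆slice-inside up S = up (out⊆ ⊆-refl)

harris-kleitman : {D U : Family n} → IsDownSet D → IsUpSet U →
  2 ^ n * card (D ∧ᶠ U) ≤ card D * card U
harris-kleitman {zero} {D} {U} _ _ with D [] | U []
... | true  | true  = ≤-refl
... | true  | false = ≤-refl
... | false | _     = ≤-refl
harris-kleitman {suc n} {D} {U} down up = begin
  2 ^ suc n * card (D ∧ᶠ U)
    ≡⟨ cong (2 ^ suc n *_) (card-slices (D ∧ᶠ U)) ⟩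
  (2 * 2 ^ n) * (card (D₀ ∧ᶠ U₀) + card (D₁ ∧ᶠ U₁))
    ≡⟨ trans (*-assoc 2 (2 ^ n) _) (cong (2 *_) (*-distribˡ-+ (2 ^ n) _ _)) ⟩
  2 * (2 ^ n * card (D₀ ∧ᶠ U₀) + 2 ^ n * card (D₁ ∧ᶠ U₁))
    ≤⟨ *-monoʳ-≤ 2 (+-mono-≤ (slice-bound outside) (slice-bound inside)) ⟩
  2 * (card D₀ * card U₀ + card D₁ * card U₁)
    ≤⟨ chebyshev (card-mono (IsDownSet⇒slice-inside⊆slice-outside down))
                 (card-mono (IsUpSet⇒slice-outside⊆slice-inside up)) ⟩
  (card D₀ + card D₁) * (card U₀ + card U₁)
    ≡⟨ sym (cong₂ _*_ (card-slices D) (card-slices U)) ⟩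
  card D * card U ∎
  where
  open ≤-Reasoning
  D₀ = slice outside D
  D₁ = slice inside D
  U₀ = slice outside U
  U₁ = slice inside U
  slice-bound : ∀ x → 2 ^ n * card (slice x D ∧ᶠ slice x U) ≤ card (slice x D) * card (slice x U)
  slice-bound x = harris-kleitman (slice-IsDownSet x down) (slice-IsUpSet x up)

disjointFromSome coversWithSome : Family n → Family n
disjointFromSome 𝓑 S = ⌊ anySubset? (λ B → T? (𝓑 B) ×-dec ¬? (nonempty? (S ∩ B))) ⌋
coversWithSome   𝓑 S = ⌊ anySubset? (λ B → T? (𝓑 B) ×-dec ≡-dec Bool._≟_ (S ∪ B) ⊤) ⌋

disjointFromSome-IsDownSet : (𝓑 : Family n) → IsDownSet (disjointFromSome 𝓑)
disjointFromSome-IsDownSet 𝓑 R⊆S S∈𝓓 with B , 𝓑B , S∩B≡∅ ← toWitness S∈𝓓 =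
  fromWitness (B , 𝓑B , λ (x , x∈R∩B) → S∩B≡∅ (x , ∩-monoˡ-⊆ R⊆S x∈R∩B))

coversWithSome-IsUpSet : (𝓑 : Family n) → IsUpSet (coversWithSome 𝓑)
coversWithSome-IsUpSet 𝓑 R⊆S R∈𝓤 with B , 𝓑B , R∪B≡⊤ ← toWitness R∈𝓤 =
  fromWitness (B , 𝓑B , ⊆-antisym ⊆⊤ (∪-monoˡ-⊆ R⊆S ∘ subst (_ ∈_) (sym R∪B≡⊤)))

∁-⊆ᶠ-disjointFromSome-∧ᶠ-coversWithSome : (𝓑 : Family n) →
  𝓑 ∘ ∁ ⊆ᶠ disjointFromSome 𝓑 ∧ᶠ coversWithSome 𝓑
∁-⊆ᶠ-disjointFromSome-∧ᶠ-coversWithSome 𝓑 S 𝓑∁S =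
  Equivalence.from (Bool.T-∧ {disjointFromSome 𝓑 S} {coversWithSome 𝓑 S})
  ( fromWitness (∁ S , 𝓑∁S , λ (x , x∈S∩∁S) → ∉⊥ (subst (x ∈_) (∩-inverseʳ S) x∈S∩∁S))
  , fromWitness (∁ S , 𝓑∁S , ∪-inverseʳ S))

CrossIU⇒Disjointᶠ : {𝓐 𝓑 : Family n} → CrossIU 𝓐 𝓑 →
  Disjointᶠ 𝓐 (disjointFromSome 𝓑 ∨ᶠ coversWithSome 𝓑)
CrossIU⇒Disjointᶠ {𝓑 = 𝓑} cross S 𝓐S = [ meets-all , misses-cover ]′ ∘ Equivalence.to Bool.T-∨
  where
  meets-all : ¬ T (disjointFromSome 𝓑 S)
  meets-all S∈𝓓 with B , 𝓑B , S∩B≡∅ ← toWitness S∈𝓓 = S∩B≡∅ (proj₁ (cross S B 𝓐S 𝓑B))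
  misses-cover : ¬ T (coversWithSome 𝓑 S)
  misses-cover S∈𝓤 with B , 𝓑B , S∪B≡⊤ ← toWitness S∈𝓤 = proj₂ (cross S B 𝓐S 𝓑B) S∪B≡⊤

theorem12 : (n : ℕ) → 1 ≤ n → (𝓐 𝓑 : Family n) → CrossIU 𝓐 𝓑 →
    card 𝓑 ≤ card 𝓐 → card 𝓐 + 3 * card 𝓑 ≤ 2 ^ n
theorem12 n _ 𝓐 𝓑 cross 𝓑≤𝓐 =
  a+3c≤N (2 ^ n) {{m^n≢0 2 n}} 𝓐+𝓓+𝓤≤2^n+𝓓∧𝓤 𝓑≤𝓓∧𝓤
    (harris-kleitman (disjointFromSome-IsDownSet 𝓑) (coversWithSome-IsUpSet 𝓑))
    𝓑≤𝓐 (card≤2^n 𝓓) (card≤2^n 𝓤)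
  where
  open ≤-Reasoning
  𝓓 = disjointFromSome 𝓑
  𝓤 = coversWithSome 𝓑
  𝓑≤𝓓∧𝓤 : card 𝓑 ≤ card (𝓓 ∧ᶠ 𝓤)
  𝓑≤𝓓∧𝓤 = begin
    card 𝓑       ≡⟨ card-∘-∁ 𝓑 ⟨
    card (𝓑 ∘ ∁) ≤⟨ card-mono (∁-⊆ᶠ-disjointFromSome-∧ᶠ-coversWithSome 𝓑) ⟩
    card (𝓓 ∧ᶠ 𝓤) ∎
  𝓐+𝓓+𝓤≤2^n+𝓓∧𝓤 : card 𝓐 + (card 𝓓 + card 𝓤) ≤ 2 ^ n + card (𝓓 ∧ᶠ 𝓤)
  𝓐+𝓓+𝓤≤2^n+𝓓∧𝓤 = begin
    card 𝓐 + (card 𝓓 + card 𝓤)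
      ≡⟨ cong (card 𝓐 +_) (card-∨ᶠ-+-card-∧ᶠ 𝓓 𝓤) ⟨
    card 𝓐 + (card (𝓓 ∨ᶠ 𝓤) + card (𝓓 ∧ᶠ 𝓤))
      ≡⟨ +-assoc (card 𝓐) _ _ ⟨
    card 𝓐 + card (𝓓 ∨ᶠ 𝓤) + card (𝓓 ∧ᶠ 𝓤)
      ≤⟨ +-monoˡ-≤ _ (card-+-card≤2^n (CrossIU⇒Disjointᶠ cross)) ⟩
    2 ^ n + card (𝓓 ∧ᶠ 𝓤) ∎
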